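{- Let $A$ be an extended simple process with $A\xRightarrow{\mathsf{tr}}_c(\mathcal{P};\Phi)$ in the compressed concrete semantics, where $\mathsf{tr}$ is a trace made of proper blocks. Then $A\xRightarrow{\mathsf{tr}'}_c(\mathcal{P};\Phi)$ for any trace $\mathsf{tr}'\equiv_\Phi\mathsf{tr}$.
   Context: Terms: signature $\Sigma$, names, first-order variables, handles $\mathcal{W}$, equational theory $\mathsf{E}$; recipes are terms of $\mathcal{T}(\Sigma,\mathcal{W})$. A fixed set $\mathcal{M}$ of ground terms (containing a public constant) defines validity: a ground term is valid if each of its subterms is $\mathsf{E}$-equal to an element of $\mathcal{M}$. Basic processes on channel $c$: $0$, $\mathtt{if}\ u=v\ \mathtt{then}\ P\ \mathtt{else}\ Q$, $\mathtt{in}(c,x).P$, $\mathtt{out}(c,u).P$; simple processes are multisets of basic processes on pairwise distinct channels; frames are finite maps $\{w\triangleright u\}$ from handles to terms; extended simple processes are $(\mathcal{P};\Phi)$ with ground valid frame. Concrete steps: $\mathtt{in}(c,x).Q\xrightarrow{\mathtt{in}(c,M)}Q\{x\mapsto u\}$ if $M$ is a recipe over $\mathrm{dom}\Phi$, $M\Phi=_\mathsf{E}u$, $M\Phi$ and $u$ valid; $\mathtt{out}(c,u).Q\xrightarrow{\mathtt{out}(c,w)}Q$ extending the frame with $w\triangleright u$ ($w$ fresh, $u$ valid); conditionals $\tau$-reduce to the then-branch iff $u=_\mathsf{E}v$ and both valid, otherwise to the else-branch. Compressed semantics: on a basic process with frame, least relations $\xrightarrow{\mathsf{tr}}_\ell$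 ($\ell\in\{i^*,i^+,o^*\}$) with: input step then $\xrightarrow{\mathsf{tr}}_{i^*}$ gives $\xrightarrow{\mathtt{in}(c,M)\cdot\mathsf{tr}}_\ell$ for $\ell\in\{i^*,i^+\}$; output step then $\xrightarrow{\mathsf{tr}}_{o^*}$ gives $\xrightarrow{\mathtt{out}(c,w)\cdot\mathsf{tr}}_\ell$ for $\ell\in\{i^*,o^*\}$; a $\tau$ step then $\xrightarrow{\mathsf{tr}}_\ell$ gives $\xrightarrow{\mathsf{tr}}_\ell$; $0$, $\mathtt{in}(c,x).Q$ and $\mathtt{out}(c,u).Q$ with $u$ not valid do $\xrightarrow{\epsilon}_{o^*}$ to themselves; $0$ and $\mathtt{out}(c,u).Q$ with $u$ not valid do $\xrightarrow{\epsilon}_{i^*}$ to $\bot$. On simple processes, a $\xrightarrow{\mathsf{tr}}_{i^+}$ step of one basic process $Q$ to $Q'$ gives $(\{Q\}\uplus\mathcal{P};\Phi)\xRightarrow{\mathsf{tr}}_c(\{Q'\}\uplus\mathcal{P};\Phi')$ if $Q'\neq\bot$ and $\xRightarrow{\mathsf{tr}}_c(\varnothing;\Phi')$ if $Q'=\bot$; steps compose by concatenating labels. Blocks. A block is $\mathtt{io}_c(\vec M,\vec w)=\mathtt{in}(c,M_1)\cdots\mathtt{in}(c,M_\ell)\cdot\mathtt{out}(c,w_1)\cdots\mathtt{out}(c,w_k)$ with recipes $M_i$ and handles $w_j$. A proper block has $\ell\ge1$ and $k\ge1$. Two blocks $\mathtt{io}_{c_1}(\vec M_1,\vec w_1)$,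 $\mathtt{io}_{c_2}(\vec M_2,\vec w_2)$ are independent if $c_1\neq c_2$, no handle of $\vec w_2$ occurs in $\vec M_1$ and no handle of $\vec w_1$ occurs in $\vec M_2$. A trace (sequence of blocks) is plausible if every recipe in an input only uses handles output earlier in the trace. For a frame $\Phi$, $(b_1=_\mathsf{E}b_2)\Phi$ means the blocks are on the same channel, $\vec M_1\Phi=_\mathsf{E}\vec M_2\Phi$ (componentwise), $\vec M_1\Phi$ and $\vec M_2\Phi$ valid, and $\vec w_1=\vec w_2$. $\equiv_\Phi$ is the smallest equivalence on plausible traces with $\mathsf{tr}\cdot b_1\cdot b_2\cdot\mathsf{tr}'\equiv_\Phi\mathsf{tr}\cdot b_2\cdot b_1\cdot\mathsf{tr}'$ when $b_1,b_2$ are independent, and $\mathsf{tr}\cdot b_1\cdot\mathsf{tr}'\equiv_\Phi\mathsf{tr}\cdot b_2\cdot\mathsf{tr}'$ when $(b_1=_\mathsf{E}b_2)\Phi$. -}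

module Defs where

open import Data.Nat using (ℕ; zero; suc; _≤_; _≟_)
open import Data.Bool using (Bool; true; false; if_then_else_)
open import Data.Maybe using (Maybe; just; nothing; maybe)
open import Data.Product using (Σ; Σ-syntax; ∃; _×_; _,_; proj₁; proj₂)
open import Data.List using (List; []; _∷_; _++_; map; length; concatMap)
open import Data.List.Relation.Unary.All using (All)
import Data.List.Relation.Unary.Any as LAny
open import Data.List.Relation.Unary.AllPairs using (AllPairs)
open import Data.List.Membership.Propositional using (_∈_)
import Data.List.Relation.Binary.Pointwise as LPw
open import Data.Vec using (Vec; []; _∷_)
import Data.Vec.Relation.Unary.Any as VAny
import Data.Vec.Relation.Unary.All as VAll
import Data.Vec.Relation.Binary.Pointwise.Inductive as VPw
open import Relation.Binary.PropositionalEquality using (_≡_; _≢_; refl; subst; sym)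
open import Relation.Nullary using (¬_; yes; no)

Chan : Set
Chan = ℕ

record Signature : Set₁ where
  field
    Sym : Set
    ar  : Sym → ℕ

module Terms (S : Signature) where
  open Signature S

  -- Terms over names, variables and handles (handles only arise from
  -- applying a frame to a recipe whose handles are not all in the domain).
  data Term : Set where
    nm  : ℕ → Term
    var : ℕ → Term
    hdl : ℕ → Term
    fn  : (f : Sym) → Vec Term (ar f) → Term

  data Recipe : Set where
    hd  : ℕ → Recipe
    rfn : (f : Sym) → Vec Recipe (ar f) → Recipe

  data Ground : Term → Set where
    g-nm : ∀ {n} → Ground (nm n)
    g-fn : ∀ {f ts} → VAll.All Ground ts → Ground (fn f ts)

  data _⊑_ (t : Term) : Term → Set where
    ⊑-here  : t ⊑ t
    ⊑-under : ∀ {f ts} → VAny.Any (t ⊑_) ts → t ⊑ fn f ts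

  mutual
    substT : (ℕ → Term) → Term → Term
    substT σ (nm n)    = nm n
    substT σ (var x)   = σ x
    substT σ (hdl w)   = hdl w
    substT σ (fn f ts) = fn f (substTs σ ts)

    substTs : ∀ {n} → (ℕ → Term) → Vec Term n → Vec Term n
    substTs σ []       = []
    substTs σ (t ∷ ts) = substT σ t ∷ substTs σ ts

  sub1 : ℕ → Term → ℕ → Term
  sub1 x u z with z ≟ x
  ... | yes _ = u
  ... | no _  = var z

  data OccursR (w : ℕ) : Recipe → Set where
    occ-here  : OccursR w (hd w)
    occ-under : ∀ {f Ms} → VAny.Any (OccursR w) Ms → OccursR w (rfn f Ms)

  Frame : Set
  Frame = List (ℕ × Term)

  lookupF : Frame → ℕ → Maybe Term
  lookupF []             w = nothing
  lookupF ((v , t) ∷ Φ) w with w ≟ v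
  ... | yes _ = just t
  ... | no _  = lookupF Φ w

  _∈dom_ : ℕ → Frame → Set
  w ∈dom Φ = LAny.Any (λ p → w ≡ proj₁ p) Φ

  mutual
    applyR : Frame → Recipe → Term
    applyR Φ (hd w)     = maybe (λ t → t) (hdl w) (lookupF Φ w)
    applyR Φ (rfn f Ms) = fn f (applyRs Φ Ms)

    applyRs : ∀ {n} → Frame → Vec Recipe n → Vec Term n
    applyRs Φ []       = []
    applyRs Φ (M ∷ Ms) = applyR Φ M ∷ applyRs Φ Ms

  RecipeOver : Frame → Recipe → Set
  RecipeOver Φ M = ∀ w → OccursR w M → w ∈dom Φ

  SameFrame : Frame → Frame → Set
  SameFrame Φ Ψ = ∀ w → lookupF Φ w ≡ lookupF Ψ w

  data Proc : Set where
    nil : Proc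
    ite : Term → Term → Proc → Proc → Proc
    inp : Chan → ℕ → Proc → Proc
    out : Chan → Term → Proc → Proc

  substP : ℕ → Term → Proc → Proc
  substP x u nil           = nil
  substP x u (ite s t P Q) = ite (substT (sub1 x u) s) (substT (sub1 x u) t) (substP x u P) (substP x u Q)
  substP x u (inp c y P) with x ≟ y
  ... | yes _ = inp c y P
  ... | no _  = inp c y (substP x u P)
  substP x u (out c t P)   = out c (substT (sub1 x u) t) (substP x u P)

  data BasicOn (c : Chan) : Proc → Set where
    b-nil : BasicOn c nil
    b-ite : ∀ {s t P Q} → BasicOn c P → BasicOn c Q → BasicOn c (ite s t P Q)
    b-inp : ∀ {x P} → BasicOn c P → BasicOn c (inp c x P)
    b-out : ∀ {u P} → BasicOn c P → BasicOn c (out c u P)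

  -- Simple process: basic processes on pairwise distinct channels
  -- (the multiset is represented by a list).
  SimpleProc : List Proc → Set
  SimpleProc 𝒫 = Σ[ cs ∈ List Chan ] (LPw.Pointwise BasicOn cs 𝒫 × AllPairs _≢_ cs)

  data Label : Set where
    lin  : Chan → Recipe → Label
    lout : Chan → ℕ → Label

  record Block : Set where
    constructor io
    field
      ch   : Chan
      ins  : List Recipe
      outs : List ℕ
  open Block public

  blockTrace : Block → List Label
  blockTrace b = map (lin (ch b)) (ins b) ++ map (lout (ch b)) (outs b)

  flatten : List Block → List Label
  flatten = concatMap blockTrace

  Proper : Block → Set
  Proper b = (1 ≤ length (ins b)) × (1 ≤ length (outs b))

  Independent : Block → Block → Set
  Independent b₁ b₂ =
    (ch b₁ ≢ ch b₂)
    × (∀ w → w ∈ outs b₂ → ¬ LAny.Any (OccursR w) (ins b₁))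
    × (∀ w → w ∈ outs b₁ → ¬ LAny.Any (OccursR w) (ins b₂))

  PlausibleFrom : List ℕ → List Block → Set
  PlausibleFrom H []       = Data.Unit.⊤
    where import Data.Unit
  PlausibleFrom H (b ∷ bs) =
    All (λ M → ∀ w → OccursR w M → w ∈ H) (ins b) × PlausibleFrom (H ++ outs b) bs

  Plausible : List Block → Set
  Plausible = PlausibleFrom []

open Terms public

record Theory : Set₁ where
  field
    sig    : Signature
  open Signature sig public
  field
    Eqs    : Term sig → Term sig → Set
    ℳ      : Term sig → Set
    ℳ-ground : ∀ t → ℳ t → Ground sig t
    ℳ-const  : Σ[ f ∈ Sym ] Σ[ p ∈ ar f ≡ 0 ] ℳ (fn f (subst (Vec (Term sig)) (sym p) []))

module Model (T : Theory) where
  open Theory T public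

  data _=E_ : Term sig → Term sig → Set where
    E-ax    : ∀ {l r} → Eqs l r → (σ : ℕ → Term sig) → substT sig σ l =E substT sig σ r
    E-refl  : ∀ {t} → t =E t
    E-sym   : ∀ {t u} → t =E u → u =E t
    E-trans : ∀ {t u v} → t =E u → u =E v → t =E v
    E-cong  : ∀ {f ts us} → VPw.Pointwise _=E_ ts us → fn f ts =E fn f us

  Valid : Term sig → Set
  Valid u = Ground sig u × (∀ t → _⊑_ sig t u → Σ[ m ∈ Term sig ] (ℳ m × t =E m))

  ExtSimple : List (Proc sig) → Frame sig → Set
  ExtSimple 𝒫 Φ = SimpleProc sig 𝒫 × AllPairs _≢_ (map proj₁ Φ) × All (λ p → Valid (proj₂ p)) Φ

  -- concrete steps of a basic process with frame (nothing = τ)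
  data Step : Proc sig → Frame sig → Maybe (Label sig) → Proc sig → Frame sig → Set where
    s-in   : ∀ {c x Q Φ M u} → RecipeOver sig Φ M → applyR sig Φ M =E u
             → Valid (applyR sig Φ M) → Valid u
             → Step (inp c x Q) Φ (just (lin c M)) (substP sig x u Q) Φ
    s-out  : ∀ {c u Q Φ w} → ¬ (_∈dom_ sig w Φ) → Valid u
             → Step (out c u Q) Φ (just (lout c w)) Q (Φ ++ ((w , u) ∷ []))
    s-then : ∀ {u v P Q Φ} → u =E v → Valid u → Valid v
             → Step (ite u v P Q) Φ nothing P Φ
    s-else : ∀ {u v P Q Φ} → ¬ (u =E v × Valid u × Valid v)
             → Step (ite u v P Q) Φ nothing Q Φ

  data Lvl : Set where
    i* i+ o* : Lvl

  data InLvl : Lvl → Set where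
    in-i* : InLvl i*
    in-i+ : InLvl i+

  data OutLvl : Lvl → Set where
    out-i* : OutLvl i*
    out-o* : OutLvl o*

  -- Comp ℓ Q Φ tr R Φ' : (Q;Φ) →^tr_ℓ (R;Φ'), R = nothing meaning ⊥
  data Comp : Lvl → Proc sig → Frame sig → List (Label sig) → Maybe (Proc sig) → Frame sig → Set where
    c-in  : ∀ {ℓ Q Φ c M Q₁ Φ₁ tr R Φ₂} → InLvl ℓ
            → Step Q Φ (just (lin c M)) Q₁ Φ₁ → Comp i* Q₁ Φ₁ tr R Φ₂
            → Comp ℓ Q Φ (lin c M ∷ tr) R Φ₂
    c-out : ∀ {ℓ Q Φ c w Q₁ Φ₁ tr R Φ₂} → OutLvl ℓ
            → Step Q Φ (just (lout c w)) Q₁ Φ₁ → Comp o* Q₁ Φ₁ tr R Φ₂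
            → Comp ℓ Q Φ (lout c w ∷ tr) R Φ₂
    c-tau : ∀ {ℓ Q Φ Q₁ Φ₁ tr R Φ₂}
            → Step Q Φ nothing Q₁ Φ₁ → Comp ℓ Q₁ Φ₁ tr R Φ₂
            → Comp ℓ Q Φ tr R Φ₂
    o-nil : ∀ {Φ} → Comp o* nil Φ [] (just nil) Φ
    o-inp : ∀ {c x Q Φ} → Comp o* (inp c x Q) Φ [] (just (inp c x Q)) Φ
    o-out : ∀ {c u Q Φ} → ¬ Valid u → Comp o* (out c u Q) Φ [] (just (out c u Q)) Φ
    i-nil : ∀ {Φ} → Comp i* nil Φ [] nothing Φ
    i-out : ∀ {c u Q Φ} → ¬ Valid u → Comp i* (out c u Q) Φ [] nothing Φ

  data CStep : List (Proc sig) → Frame sig → List (Label sig) → List (Proc sig) → Frame sig → Set where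
    cs-live : ∀ {pre Q post Φ tr Q' Φ'} → Comp i+ Q Φ tr (just Q') Φ'
              → CStep (pre ++ Q ∷ post) Φ tr (pre ++ Q' ∷ post) Φ'
    cs-dead : ∀ {pre Q post Φ tr Φ'} → Comp i+ Q Φ tr nothing Φ'
              → CStep (pre ++ Q ∷ post) Φ tr [] Φ'

  data CSteps : List (Proc sig) → Frame sig → List (Label sig) → List (Proc sig) → Frame sig → Set where
    done : ∀ {𝒫 Φ} → CSteps 𝒫 Φ [] 𝒫 Φ
    more : ∀ {𝒫 Φ tr₁ 𝒫₁ Φ₁ tr₂ 𝒫₂ Φ₂}
           → CStep 𝒫 Φ tr₁ 𝒫₁ Φ₁ → CSteps 𝒫₁ Φ₁ tr₂ 𝒫₂ Φ₂
           → CSteps 𝒫 Φ (tr₁ ++ tr₂) 𝒫₂ Φ₂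

  BlockEq : Frame sig → Block sig → Block sig → Set
  BlockEq Φ b₁ b₂ =
    (ch b₁ ≡ ch b₂)
    × LPw.Pointwise (λ M₁ M₂ → (applyR sig Φ M₁ =E applyR sig Φ M₂)
                               × Valid (applyR sig Φ M₁) × Valid (applyR sig Φ M₂))
                    (ins b₁) (ins b₂)
    × (outs b₁ ≡ outs b₂)

  data TrEquiv (Φ : Frame sig) : List (Block sig) → List (Block sig) → Set where
    te-refl  : ∀ {tr} → Plausible sig tr → TrEquiv Φ tr tr
    te-sym   : ∀ {tr tr'} → TrEquiv Φ tr tr' → TrEquiv Φ tr' tr
    te-trans : ∀ {tr tr' tr''} → TrEquiv Φ tr tr' → TrEquiv Φ tr' tr'' → TrEquiv Φ tr tr''
    te-swap  : ∀ {tr b₁ b₂ tr'}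
               → Plausible sig (tr ++ b₁ ∷ b₂ ∷ tr') → Plausible sig (tr ++ b₂ ∷ b₁ ∷ tr')
               → Independent sig b₁ b₂
               → TrEquiv Φ (tr ++ b₁ ∷ b₂ ∷ tr') (tr ++ b₂ ∷ b₁ ∷ tr')
    te-repl  : ∀ {tr b₁ b₂ tr'}
               → Plausible sig (tr ++ b₁ ∷ tr') → Plausible sig (tr ++ b₂ ∷ tr')
               → BlockEq Φ b₁ b₂
               → TrEquiv Φ (tr ++ b₁ ∷ tr') (tr ++ b₂ ∷ tr')

-- Each compressed step emits some inputs followed by at least one output, and the next step
-- begins with an input; so an execution of a trace of proper blocks performs exactly one block
-- per step, and it suffices to show that block-wise executions reaching (𝒫; Φ) up to frame
-- equality are preserved by the generators of ≡Φ. Independent blocks are run by different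
-- processes (they use different channels) and neither reads a handle the other creates, so they
-- can be run in either order; the frame extensions they add have disjoint domains, hence commute.
-- A block can be replaced by one whose input recipes are 𝖤-equal and valid under Φ, because each
-- input recipe only mentions handles of the frame at that point, on which Φ agrees with it.

module Submission where

open import Defs
open import Data.Product using (Σ-syntax; _×_)
open import Data.List using (List)
open import Data.List.Relation.Unary.All using (All)
open import Data.List.Relation.Binary.Permutation.Propositional using (_↭_)

open import Data.Empty using (⊥; ⊥-elim)
open import Data.List using ([]; _∷_; _++_; map)
open import Data.List.Membership.Propositional using (_∈_; lose)
open import Data.List.Properties using (++-assoc; ++-identityʳ; ++-conicalʳ)
open import Data.List.Relation.Binary.Permutation.Propositional using (↭-refl)
import Data.List.Relation.Binary.Pointwise as Pointwise
open Pointwise using (Pointwise; []; _∷_)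
open import Data.List.Relation.Unary.All using ([]; _∷_)
import Data.List.Relation.Unary.All as All
import Data.List.Relation.Unary.All.Properties as AllP
open import Data.List.Relation.Unary.Any using (here; there)
import Data.List.Relation.Unary.Any as Any
import Data.List.Relation.Unary.Any.Properties as AnyP
open import Data.Maybe using (Maybe; just; nothing; maybe; _<∣>_)
open import Data.Maybe.Properties using (<∣>-identityʳ)
open import Data.Nat using (ℕ; _≟_)
open import Data.Product using (_,_; proj₁; map₁)
open import Data.Product.Properties using (,-injective)
open import Data.Sum using (_⊎_; inj₁; inj₂)
open import Data.Unit using (⊤; tt)
open import Data.Vec using (Vec; []; _∷_)
import Data.Vec.Relation.Unary.Any as VAny
open import Function.Base using (_∘_)
open import Function.Bundles using (_⇔_; mk⇔; module Equivalence)
open import Function.Construct.Composition using (_⇔-∘_)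
open import Function.Construct.Identity using (⇔-id)
open import Function.Construct.Symmetry using (⇔-sym)
open import Relation.Binary.PropositionalEquality
  using (_≡_; _≢_; refl; sym; trans; cong; cong₂; subst; subst₂; module ≡-Reasoning)
open import Relation.Nullary using (¬_; yes; no)

module FrameProperties (S : Signature) where

  Dom : ℕ → Frame S → Set
  Dom w Φ = _∈dom_ S w Φ

  infixl 9 _!_
  _!_ : Frame S → ℕ → Maybe (Term S)
  Φ ! w = lookupF S Φ w

  infix 4 _⊆F_
  record _⊆F_ (Φ Ψ : Frame S) : Set where
    constructor mk⊆F
    field ⊆F-lookup : ∀ w → Dom w Φ → Ψ ! w ≡ Φ ! w
  open _⊆F_ public

  AgreeOn : Frame S → Frame S → Recipe S → Set
  AgreeOn Φ Ψ M = ∀ w → OccursR S w M → Dom w Φ → Ψ ! w ≡ Φ ! w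

  private variable
    Φ Ψ Χ : Frame S
    M : Recipe S
    w : ℕ

  dom⇒just : ∀ Φ → Dom w Φ → Σ[ t ∈ Term S ] Φ ! w ≡ just t
  dom⇒just {w} ((v , t) ∷ Φ) d with w ≟ v
  ... | yes _ = t , refl
  dom⇒just ((v , t) ∷ Φ) (here w≡v) | no w≢v = ⊥-elim (w≢v w≡v)
  dom⇒just ((v , t) ∷ Φ) (there d)  | no _   = dom⇒just Φ d

  just⇒dom : ∀ {t} Φ → Φ ! w ≡ just t → Dom w Φ
  just⇒dom {w} ((v , t) ∷ Φ) eq with w ≟ v
  ... | yes w≡v = here w≡v
  ... | no _    = there (just⇒dom Φ eq)

  dom-transfer : ∀ Φ Ψ → Ψ ! w ≡ Φ ! w → Dom w Φ → Dom w Ψ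
  dom-transfer Φ Ψ eq d with dom⇒just Φ d
  ... | _ , defined = just⇒dom Ψ (trans eq defined)

  lookup-++ : ∀ Φ Ψ w → (Φ ++ Ψ) ! w ≡ Φ ! w <∣> Ψ ! w
  lookup-++ [] Ψ w = refl
  lookup-++ ((v , t) ∷ Φ) Ψ w with w ≟ v
  ... | yes _ = refl
  ... | no _  = lookup-++ Φ Ψ w

  lookup-++-comm : ∀ Φ Ψ w → (Dom w Φ → ¬ Dom w Ψ) → (Φ ++ Ψ) ! w ≡ (Ψ ++ Φ) ! w
  lookup-++-comm Φ Ψ w disjoint =
    trans (lookup-++ Φ Ψ w) (trans (commute (Φ ! w) (Ψ ! w) refl refl) (sym (lookup-++ Ψ Φ w)))
    where
      commute : ∀ a b → Φ ! w ≡ a → Ψ ! w ≡ b → a <∣> b ≡ b <∣> a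
      commute nothing  b        _   _   = sym (<∣>-identityʳ b)
      commute (just a) nothing  _   _   = refl
      commute (just a) (just b) inΦ inΨ = ⊥-elim (disjoint (just⇒dom Φ inΦ) (just⇒dom Ψ inΨ))

  ⊆F-++ : ∀ Φ Ψ → Φ ⊆F Φ ++ Ψ
  ⊆F-++ Φ Ψ = mk⊆F lookup-prefix
    where
      lookup-prefix : ∀ w → Dom w Φ → (Φ ++ Ψ) ! w ≡ Φ ! w
      lookup-prefix w d with dom⇒just Φ d
      ... | _ , defined = trans (lookup-++ Φ Ψ w) (trans (cong (_<∣> Ψ ! w) defined) (sym defined))

  ⊆F-dom : Φ ⊆F Ψ → Dom w Φ → Dom w Ψ
  ⊆F-dom {Φ} {Ψ} sub d = dom-transfer Φ Ψ (⊆F-lookup sub _ d) d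

  ⊆F-trans : Φ ⊆F Ψ → Ψ ⊆F Χ → Φ ⊆F Χ
  ⊆F-trans sub sub′ = mk⊆F λ w d → trans (⊆F-lookup sub′ w (⊆F-dom sub d)) (⊆F-lookup sub w d)

  SameFrame-++ : ∀ Φ Ψ E → SameFrame S Φ Ψ → SameFrame S (Φ ++ E) (Ψ ++ E)
  SameFrame-++ Φ Ψ E same w =
    trans (lookup-++ Φ E w) (trans (cong (_<∣> E ! w) (same w)) (sym (lookup-++ Ψ E w)))

  SameFrame-++-comm : ∀ Φ A B → (∀ w → Dom w A → ¬ Dom w B) → SameFrame S ((Φ ++ A) ++ B) ((Φ ++ B) ++ A)
  SameFrame-++-comm Φ A B disjoint w = begin
    ((Φ ++ A) ++ B) ! w      ≡⟨ cong (_! w) (++-assoc Φ A B) ⟩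
    (Φ ++ A ++ B) ! w        ≡⟨ lookup-++ Φ (A ++ B) w ⟩
    Φ ! w <∣> (A ++ B) ! w   ≡⟨ cong (Φ ! w <∣>_) (lookup-++-comm A B w (disjoint w)) ⟩
    Φ ! w <∣> (B ++ A) ! w   ≡⟨ lookup-++ Φ (B ++ A) w ⟨
    (Φ ++ B ++ A) ! w        ≡⟨ cong (_! w) (++-assoc Φ B A) ⟨
    ((Φ ++ B) ++ A) ! w      ∎
    where open ≡-Reasoning

  mutual
    applyR-local : ∀ M → (∀ w → OccursR S w M → Ψ ! w ≡ Φ ! w) → applyR S Ψ M ≡ applyR S Φ M
    applyR-local (hd w)     agree = cong (maybe (λ t → t) (hdl w)) (agree w occ-here)
    applyR-local (rfn f Ms) agree = cong (fn f) (applyRs-local Ms (λ w o → agree w (occ-under o)))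

    applyRs-local : ∀ {n} (Ms : Vec (Recipe S) n) → (∀ w → VAny.Any (OccursR S w) Ms → Ψ ! w ≡ Φ ! w)
                  → applyRs S Ψ Ms ≡ applyRs S Φ Ms
    applyRs-local []       agree = refl
    applyRs-local (M ∷ Ms) agree =
      cong₂ _∷_ (applyR-local M (λ w o → agree w (VAny.here o)))
                (applyRs-local Ms (λ w o → agree w (VAny.there o)))

  RecipeOver-transfer : RecipeOver S Φ M → AgreeOn Φ Ψ M → RecipeOver S Ψ M
  RecipeOver-transfer {Φ} {Ψ = Ψ} over agree w o = dom-transfer Φ Ψ (agree w o (over w o)) (over w o)

  applyR-transfer : RecipeOver S Φ M → AgreeOn Φ Ψ M → applyR S Ψ M ≡ applyR S Φ M
  applyR-transfer {M = M} over agree = applyR-local M (λ w o → agree w o (over w o))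

module LabelProperties (S : Signature) where

  data IsIn : Label S → Set where
    is-in : ∀ {c M} → IsIn (lin c M)

  data IsOut : Label S → Set where
    is-out : ∀ {c w} → IsOut (lout c w)

  NoLeadingOutput : List (Label S) → Set
  NoLeadingOutput []             = ⊤
  NoLeadingOutput (lin _ _ ∷ _)  = ⊤
  NoLeadingOutput (lout _ _ ∷ _) = ⊥

  data BlockShaped : List (Label S) → Set where
    in-then  : ∀ {c M tr} → BlockShaped tr → BlockShaped (lin c M ∷ tr)
    out-then : ∀ {c w tr} → All IsOut tr → BlockShaped (lout c w ∷ tr)

  outHandles : List (Label S) → List ℕ
  outHandles []              = []
  outHandles (lin _ _ ∷ tr)  = outHandles tr
  outHandles (lout _ w ∷ tr) = w ∷ outHandles tr

  private variable
    tr tr′ x x′ : List (Label S)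
    c : Chan
    M : Recipe S

  outputs-∌-input : All IsOut tr → ¬ (lin c M ∈ tr)
  outputs-∌-input outputs m with All.lookup outputs m
  ... | ()

  BlockShaped-has-output : BlockShaped tr → ¬ All IsIn tr
  BlockShaped-has-output (in-then t) (_ ∷ inputs) = BlockShaped-has-output t inputs
  BlockShaped-has-output (out-then _) (() ∷ _)

  splitOutputs : List (Label S) → List (Label S) × List (Label S)
  splitOutputs []              = [] , []
  splitOutputs (lin c M ∷ tr)  = [] , lin c M ∷ tr
  splitOutputs (lout c w ∷ tr) = map₁ (lout c w ∷_) (splitOutputs tr)

  splitBlock : List (Label S) → List (Label S) × List (Label S)
  splitBlock []              = [] , []
  splitBlock (lin c M ∷ tr)  = map₁ (lin c M ∷_) (splitBlock tr)
  splitBlock (lout c w ∷ tr) = splitOutputs (lout c w ∷ tr)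

  splitOutputs-++ : All IsOut tr → NoLeadingOutput x → splitOutputs (tr ++ x) ≡ (tr , x)
  splitOutputs-++ {x = []}          [] _  = refl
  splitOutputs-++ {x = lin _ _ ∷ _} [] _  = refl
  splitOutputs-++ {x = lout _ _ ∷ _} [] ()
  splitOutputs-++ (is-out ∷ outputs) nlo = cong (map₁ (lout _ _ ∷_)) (splitOutputs-++ outputs nlo)

  splitBlock-++ : BlockShaped tr → NoLeadingOutput x → splitBlock (tr ++ x) ≡ (tr , x)
  splitBlock-++ (in-then t)        nlo = cong (map₁ (lin _ _ ∷_)) (splitBlock-++ t nlo)
  splitBlock-++ (out-then outputs) nlo = splitOutputs-++ (is-out ∷ outputs) nlo

  BlockShaped-++-cancel : BlockShaped tr → BlockShaped tr′ → NoLeadingOutput x → NoLeadingOutput x′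
                        → tr ++ x ≡ tr′ ++ x′ → tr ≡ tr′ × x ≡ x′
  BlockShaped-++-cancel t t′ nlo nlo′ eq =
    ,-injective (trans (sym (splitBlock-++ t nlo)) (trans (cong splitBlock eq) (splitBlock-++ t′ nlo′)))

  Proper⇒BlockShaped : ∀ b → Proper S b → BlockShaped (blockTrace S b)
  Proper⇒BlockShaped (io c Ms [])       (_ , ())
  Proper⇒BlockShaped (io c Ms (w ∷ Os)) _ = inputs Ms
    where
      outputs : ∀ Os → All IsOut (map (lout c) Os)
      outputs []       = []
      outputs (_ ∷ Os) = is-out ∷ outputs Os

      inputs : ∀ Ms → BlockShaped (map (lin c) Ms ++ lout c w ∷ map (lout c) Os)
      inputs []       = out-then (outputs Os)
      inputs (_ ∷ Ms) = in-then (inputs Ms)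

  NoLeadingOutput-flatten : ∀ {bs} → All (Proper S) bs → NoLeadingOutput (flatten S bs)
  NoLeadingOutput-flatten {[]}                  []              = tt
  NoLeadingOutput-flatten {io c [] Os ∷ _}      ((() , _) ∷ _)
  NoLeadingOutput-flatten {io c (_ ∷ _) Os ∷ _} (_ ∷ _)         = tt

  blockTrace-head-channel : ∀ b {rest} → blockTrace S b ≡ lin c M ∷ rest → c ≡ ch b
  blockTrace-head-channel (io _ [] [])      ()
  blockTrace-head-channel (io _ [] (_ ∷ _)) ()
  blockTrace-head-channel (io _ (_ ∷ _) _)  refl = refl

  blockTrace-outHandles : ∀ b → outHandles (blockTrace S b) ≡ outs b
  blockTrace-outHandles (io c Ms Os) = inputs Ms
    where
      outputs : ∀ Os → outHandles (map (lout c) Os) ≡ Os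
      outputs []       = refl
      outputs (w ∷ Os) = cong (w ∷_) (outputs Os)

      inputs : ∀ Ms → outHandles (map (lin c) Ms ++ map (lout c) Os) ≡ Os
      inputs []       = outputs Os
      inputs (_ ∷ Ms) = inputs Ms

  ∈-blockTrace-ins : ∀ b → lin c M ∈ blockTrace S b → M ∈ ins b
  ∈-blockTrace-ins (io c Ms Os) m with AnyP.++⁻ (map (lin c) Ms) m
  ... | inj₁ m-in  = Any.map (λ { refl → refl }) (AnyP.map⁻ m-in)
  ... | inj₂ m-out with Any.satisfied (AnyP.map⁻ m-out)
  ...   | _ , ()

module ProcessProperties (S : Signature) where

  data Update : List (Proc S) → Proc S → Proc S → List (Proc S) → Set where
    upd-here  : ∀ {P P′ 𝒫} → Update (P ∷ 𝒫) P P′ (P′ ∷ 𝒫)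
    upd-there : ∀ {P P′ Q 𝒫 𝒫′} → Update 𝒫 P P′ 𝒫′ → Update (Q ∷ 𝒫) P P′ (Q ∷ 𝒫′)

  private variable
    P P′ P₁ P₁′ P₂ P₂′ : Proc S
    𝒫 𝒫′ 𝒫₁ 𝒫₂ : List (Proc S)
    c : Chan
    cs : List Chan

  substP-BasicOn : ∀ x u → BasicOn S c P → BasicOn S c (substP S x u P)
  substP-BasicOn x u b-nil = b-nil
  substP-BasicOn x u (b-ite on on′) = b-ite (substP-BasicOn x u on) (substP-BasicOn x u on′)
  substP-BasicOn x u (b-inp {x = y} on) with x ≟ y
  ... | yes _ = b-inp on
  ... | no _  = b-inp (substP-BasicOn x u on)
  substP-BasicOn x u (b-out on) = b-out (substP-BasicOn x u on)

  Update-++ : ∀ pre {post} → Update (pre ++ P ∷ post) P P′ (pre ++ P′ ∷ post)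
  Update-++ []        = upd-here
  Update-++ (_ ∷ pre) = upd-there (Update-++ pre)

  Update-split : Update 𝒫 P P′ 𝒫′
               → Σ[ pre ∈ List (Proc S) ] Σ[ post ∈ List (Proc S) ] 𝒫 ≡ pre ++ P ∷ post × 𝒫′ ≡ pre ++ P′ ∷ post
  Update-split upd-here = [] , _ , refl , refl
  Update-split (upd-there {Q = Q} u) with Update-split u
  ... | pre , post , refl , refl = Q ∷ pre , post , refl , refl

  Update-BasicOn : Pointwise (BasicOn S) cs 𝒫 → Update 𝒫 P P′ 𝒫′
                 → (∀ {c} → BasicOn S c P → BasicOn S c P′) → Pointwise (BasicOn S) cs 𝒫′
  Update-BasicOn (on ∷ basic) upd-here      preserves = preserves on ∷ basic
  Update-BasicOn (on ∷ basic) (upd-there u) preserves = on ∷ Update-BasicOn basic u preserves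

  Update-comm : Pointwise (BasicOn S) cs 𝒫 → Update 𝒫 P₁ P₁′ 𝒫₁ → Update 𝒫₁ P₂ P₂′ 𝒫₂
              → (∀ {c} → BasicOn S c P₁ → BasicOn S c P₁′) → (∀ {c} → BasicOn S c P₁ → ¬ BasicOn S c P₂)
              → Σ[ 𝒫₁′ ∈ List (Proc S) ] Update 𝒫 P₂ P₂′ 𝒫₁′ × Update 𝒫₁′ P₁ P₁′ 𝒫₂
  Update-comm (on ∷ _) upd-here upd-here preserves apart = ⊥-elim (apart on (preserves on))
  Update-comm _ upd-here       (upd-there u₂) _ _ = _ , upd-there u₂ , upd-here
  Update-comm _ (upd-there u₁) upd-here       _ _ = _ , upd-here , upd-there u₁
  Update-comm (_ ∷ basic) (upd-there u₁) (upd-there u₂) preserves apart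
    with Update-comm basic u₁ u₂ preserves apart
  ... | _ , u₂′ , u₁′ = _ , upd-there u₂′ , upd-there u₁′

module Compressed (T : Theory) where
  open Model T
  open FrameProperties sig
  open LabelProperties sig
  open ProcessProperties sig

  private variable
    ℓ ℓ₁ ℓ₂ : Lvl
    Q Q′ Q₁ Q₂ : Proc sig
    R R₁ R₂ : Maybe (Proc sig)
    Φ Φ′ Φ₀ Φ₁ Φ₂ Ψ : Frame sig
    tr tr₁ tr₂ : List (Label sig)
    b b₁ b₂ : Block sig
    bs bs′ : List (Block sig)
    c c′ : Chan
    M : Recipe sig
    w : ℕ

  RecipeEq : Frame sig → Recipe sig → Recipe sig → Set
  RecipeEq Φ M₁ M₂ = (applyR sig Φ M₁ =E applyR sig Φ M₂) × Valid (applyR sig Φ M₁) × Valid (applyR sig Φ M₂)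

  Comp-o*-outputs : Comp o* Q Φ tr R Φ′ → All IsOut tr
  Comp-o*-outputs (c-in () _ _)
  Comp-o*-outputs (c-out _ _ C) = is-out ∷ Comp-o*-outputs C
  Comp-o*-outputs (c-tau _ C)   = Comp-o*-outputs C
  Comp-o*-outputs o-nil         = []
  Comp-o*-outputs o-inp         = []
  Comp-o*-outputs (o-out _)     = []

  Comp-o*-alive : ¬ Comp o* Q Φ tr nothing Φ′
  Comp-o*-alive (c-in () _ _)
  Comp-o*-alive (c-out _ _ C) = Comp-o*-alive C
  Comp-o*-alive (c-tau _ C)   = Comp-o*-alive C

  Comp-dead-inputs : Comp ℓ Q Φ tr nothing Φ′ → All IsIn tr
  Comp-dead-inputs (c-in _ _ C)  = is-in ∷ Comp-dead-inputs C
  Comp-dead-inputs (c-out _ _ C) = ⊥-elim (Comp-o*-alive C)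
  Comp-dead-inputs (c-tau _ C)   = Comp-dead-inputs C
  Comp-dead-inputs i-nil         = []
  Comp-dead-inputs (i-out _)     = []

  Comp-live-BlockShaped : InLvl ℓ → Comp ℓ Q Φ tr (just Q′) Φ′ → BlockShaped tr
  Comp-live-BlockShaped _      (c-in _ _ C)      = in-then (Comp-live-BlockShaped in-i* C)
  Comp-live-BlockShaped in-i*  (c-out _ _ C)     = out-then (Comp-o*-outputs C)
  Comp-live-BlockShaped in-i+  (c-out () _ _)
  Comp-live-BlockShaped lvl    (c-tau _ C)       = Comp-live-BlockShaped lvl C

  Comp-i+-begins : Comp i+ Q Φ tr R Φ′
                 → Σ[ c ∈ Chan ] Σ[ M ∈ Recipe sig ] Σ[ rest ∈ List (Label sig) ] tr ≡ lin c M ∷ rest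
  Comp-i+-begins (c-in _ _ _)   = _ , _ , _ , refl
  Comp-i+-begins (c-out () _ _)
  Comp-i+-begins (c-tau _ C)    = Comp-i+-begins C

  Comp-input-channel : Comp i+ Q Φ (lin c M ∷ tr) R Φ′ → BasicOn sig c′ Q → c ≡ c′
  Comp-input-channel (c-in _ (s-in _ _ _ _) _)  (b-inp _)    = refl
  Comp-input-channel (c-tau (s-then _ _ _) C)   (b-ite on _) = Comp-input-channel C on
  Comp-input-channel (c-tau (s-else _) C)       (b-ite _ on) = Comp-input-channel C on

  Comp-block-channel : ∀ b → Comp i+ Q Φ (blockTrace sig b) R Φ′ → BasicOn sig c Q → ch b ≡ c
  Comp-block-channel b C on with Comp-i+-begins C
  ... | _ , _ , _ , eq =
    trans (sym (blockTrace-head-channel b eq)) (Comp-input-channel (subst (λ tr → Comp i+ _ _ tr _ _) eq C) on)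

  Comp-BasicOn : Comp ℓ Q Φ tr (just Q′) Φ′ → BasicOn sig c Q → BasicOn sig c Q′
  Comp-BasicOn (c-in _ (s-in _ _ _ _) C) (b-inp on)   = Comp-BasicOn C (substP-BasicOn _ _ on)
  Comp-BasicOn (c-out _ (s-out _ _) C)   (b-out on)   = Comp-BasicOn C on
  Comp-BasicOn (c-tau (s-then _ _ _) C)  (b-ite on _) = Comp-BasicOn C on
  Comp-BasicOn (c-tau (s-else _) C)      (b-ite _ on) = Comp-BasicOn C on
  Comp-BasicOn o-nil     on = on
  Comp-BasicOn o-inp     on = on
  Comp-BasicOn (o-out _) on = on

  Comp-fresh : Comp ℓ Q Φ tr R Φ′ → w ∈ outHandles tr → ¬ Dom w Φ
  Comp-fresh (c-in _ (s-in _ _ _ _) C)   output         = Comp-fresh C output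
  Comp-fresh (c-out _ (s-out fresh _) _) (here refl)    = fresh
  Comp-fresh (c-out _ (s-out _ _) C)     (there output) = λ d → Comp-fresh C output (AnyP.++⁺ˡ d)
  Comp-fresh (c-tau (s-then _ _ _) C)    output         = Comp-fresh C output
  Comp-fresh (c-tau (s-else _) C)        output         = Comp-fresh C output

  reframe-halted : (∀ {Ψ} → Comp ℓ Q Ψ [] R Ψ) → ∀ Ψ
         → Σ[ ext ∈ Frame sig ] Φ ≡ Φ ++ ext × map proj₁ ext ≡ [] × Comp ℓ Q Ψ [] R (Ψ ++ ext)
  reframe-halted {Φ = Φ} C Ψ =
    [] , sym (++-identityʳ Φ) , refl , subst (Comp _ _ Ψ [] _) (sym (++-identityʳ Ψ)) C

  InputsAgree : Frame sig → Frame sig → List (Label sig) → Set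
  InputsAgree Φ Ψ tr = ∀ {c M} → lin c M ∈ tr → AgreeOn Φ Ψ M

  OutputsFresh : Frame sig → Frame sig → List (Label sig) → Set
  OutputsFresh Φ Ψ tr = ∀ {w} → w ∈ outHandles tr → Dom w Ψ → Dom w Φ

  -- A computation only reads the frame on the handles of its input recipes and only
  -- needs its output handles to be fresh, so it can be replayed on any frame Ψ that
  -- agrees there; it then extends Ψ by the same bindings.
  Comp-reframe : Comp ℓ Q Φ tr R Φ′ → ∀ Ψ → InputsAgree Φ Ψ tr → OutputsFresh Φ Ψ tr
    → Σ[ ext ∈ Frame sig ] Φ′ ≡ Φ ++ ext × map proj₁ ext ≡ outHandles tr × Comp ℓ Q Ψ tr R (Ψ ++ ext)
  Comp-reframe {Φ = Φ} (c-in {M = M} lvl (s-in over eq valid valid′) C) Ψ agree fresh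
    with Comp-reframe C Ψ (λ m → agree (there m)) fresh
  ... | ext , Φ′≡ , dom , C′ =
    ext , Φ′≡ , dom ,
    c-in lvl (s-in (RecipeOver-transfer over agreeM) (subst (λ t → t =E _) (sym applied) eq)
                   (subst Valid (sym applied) valid) valid′) C′
    where
      agreeM : AgreeOn Φ Ψ M
      agreeM = agree (here refl)
      applied : applyR sig Ψ M ≡ applyR sig Φ M
      applied = applyR-transfer over agreeM
  Comp-reframe {Φ = Φ} {tr = lout _ w ∷ tr} (c-out lvl (s-out {u = u} notDom valid) C) Ψ agree fresh
    with Comp-reframe C (Ψ ++ (w , u) ∷ []) (⊥-elim ∘ outputs-∌-input (Comp-o*-outputs C)) fresh′
    where
      fresh′ : OutputsFresh (Φ ++ (w , u) ∷ []) (Ψ ++ (w , u) ∷ []) tr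
      fresh′ output d with AnyP.++⁻ Ψ d
      ... | inj₁ dΨ = AnyP.++⁺ˡ (fresh (there output) dΨ)
      ... | inj₂ dw = AnyP.++⁺ʳ Φ dw
  ... | ext , Φ′≡ , dom , C′ =
    (w , u) ∷ ext , trans Φ′≡ (++-assoc Φ _ ext) , cong (w ∷_) dom ,
    c-out lvl (s-out (notDom ∘ fresh (here refl)) valid) (subst (Comp o* _ _ _ _) (++-assoc Ψ _ ext) C′)
  Comp-reframe (c-tau (s-then eq valid valid′) C) Ψ agree fresh with Comp-reframe C Ψ agree fresh
  ... | ext , Φ′≡ , dom , C′ = ext , Φ′≡ , dom , c-tau (s-then eq valid valid′) C′
  Comp-reframe (c-tau (s-else neq) C) Ψ agree fresh with Comp-reframe C Ψ agree fresh
  ... | ext , Φ′≡ , dom , C′ = ext , Φ′≡ , dom , c-tau (s-else neq) C′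
  Comp-reframe o-nil       Ψ _ _ = reframe-halted o-nil Ψ
  Comp-reframe o-inp       Ψ _ _ = reframe-halted o-inp Ψ
  Comp-reframe (o-out inv) Ψ _ _ = reframe-halted (o-out inv) Ψ
  Comp-reframe i-nil       Ψ _ _ = reframe-halted i-nil Ψ
  Comp-reframe (i-out inv) Ψ _ _ = reframe-halted (i-out inv) Ψ

  Comp-extends : Comp ℓ Q Φ tr R Φ′ → Σ[ ext ∈ Frame sig ] Φ′ ≡ Φ ++ ext × map proj₁ ext ≡ outHandles tr
  Comp-extends {Φ = Φ} C with Comp-reframe C Φ (λ _ _ _ _ → refl) (λ _ d → d)
  ... | ext , Φ′≡ , dom , _ = ext , Φ′≡ , dom

  Comp-⊆F : Comp ℓ Q Φ tr R Φ′ → Φ ⊆F Φ′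
  Comp-⊆F {Φ = Φ} C with Comp-extends C
  ... | ext , refl , _ = ⊆F-++ Φ ext

  Comp-dom⁺ : Comp ℓ Q Φ tr R Φ′ → w ∈ outHandles tr → Dom w Φ′
  Comp-dom⁺ {Φ = Φ} {w = w} C output with Comp-extends C
  ... | ext , refl , dom = AnyP.++⁺ʳ Φ (AnyP.map⁻ (subst (w ∈_) (sym dom) output))

  Comp-dom⁻ : Comp ℓ Q Φ tr R Φ′ → Dom w Φ′ → Dom w Φ ⊎ w ∈ outHandles tr
  Comp-dom⁻ {Φ = Φ} {w = w} C d with Comp-extends C
  ... | ext , refl , dom with AnyP.++⁻ Φ d
  ...   | inj₁ dΦ   = inj₁ dΦ
  ...   | inj₂ dext = inj₂ (subst (w ∈_) dom (AnyP.map⁺ dext))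

  Comp-advance : Comp ℓ₁ Q₁ Φ tr₁ R₁ Φ₁ → Comp ℓ₂ Q₂ Φ₁ tr₂ R₂ Φ₂
    → (∀ {c M w} → lin c M ∈ tr₂ → OccursR sig w M → w ∈ outHandles tr₁ → ⊥)
    → Σ[ E ∈ Frame sig ] Φ₂ ≡ Φ₁ ++ E × (∀ w → Dom w E → ¬ Dom w Φ₁) × Comp ℓ₂ Q₂ Φ tr₂ R₂ (Φ ++ E)
  Comp-advance {Φ = Φ} {Φ₁ = Φ₁} {tr₂ = tr₂} C₁ C₂ independent with Comp-reframe C₂ Φ agree fresh
    where
      agree : InputsAgree Φ₁ Φ tr₂
      agree m w o d with Comp-dom⁻ C₁ d
      ... | inj₁ dΦ  = sym (⊆F-lookup (Comp-⊆F C₁) w dΦ)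
      ... | inj₂ output = ⊥-elim (independent m o output)
      fresh : OutputsFresh Φ₁ Φ tr₂
      fresh _ = ⊆F-dom (Comp-⊆F C₁)
  ... | E , Φ₂≡ , dom , C₂′ =
    E , Φ₂≡ , (λ w d → Comp-fresh C₂ (subst (w ∈_) dom (AnyP.map⁺ d))) , C₂′

  Comp-postpone : Comp ℓ Q Φ tr R Φ₁ → ∀ E → (∀ w → Dom w E → ¬ Dom w Φ₁)
    → Σ[ Ψ ∈ Frame sig ] Comp ℓ Q (Φ ++ E) tr R Ψ × SameFrame sig Ψ (Φ₁ ++ E)
  Comp-postpone {Φ = Φ} {tr = tr} {Φ₁ = Φ₁} C E disjoint with Comp-reframe C (Φ ++ E) agree fresh
    where
      agree : InputsAgree Φ (Φ ++ E) tr
      agree _ w _ = ⊆F-lookup (⊆F-++ Φ E) w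
      fresh : OutputsFresh Φ (Φ ++ E) tr
      fresh {w} output d with AnyP.++⁻ Φ d
      ... | inj₁ dΦ = dΦ
      ... | inj₂ dE = ⊥-elim (disjoint w dE (Comp-dom⁺ C output))
  ... | ext , Φ₁≡ , _ , C′ =
    (Φ ++ E) ++ ext , C′ ,
    subst (λ F → SameFrame sig ((Φ ++ E) ++ ext) (F ++ E)) (sym Φ₁≡) (SameFrame-++-comm Φ E ext disjoint′)
    where
      disjoint′ : ∀ w → Dom w E → ¬ Dom w ext
      disjoint′ w dE dext = disjoint w dE (subst (Dom w) (sym Φ₁≡) (AnyP.++⁺ʳ Φ dext))

  Comp-swap : ∀ b₁ b₂ → Independent sig b₁ b₂
    → Comp ℓ₁ Q₁ Φ (blockTrace sig b₁) R₁ Φ₁ → Comp ℓ₂ Q₂ Φ₁ (blockTrace sig b₂) R₂ Φ₂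
    → Σ[ Ψ₁ ∈ Frame sig ] Σ[ Ψ₂ ∈ Frame sig ]
        Comp ℓ₂ Q₂ Φ (blockTrace sig b₂) R₂ Ψ₁ × Comp ℓ₁ Q₁ Ψ₁ (blockTrace sig b₁) R₁ Ψ₂
        × SameFrame sig Ψ₂ Φ₂
  Comp-swap {Φ = Φ} b₁ b₂ (_ , _ , outs₁∉ins₂) C₁ C₂ with Comp-advance C₁ C₂ independent
    where
      independent : ∀ {c M w} → lin c M ∈ blockTrace sig b₂ → OccursR sig w M
                  → w ∈ outHandles (blockTrace sig b₁) → ⊥
      independent m o output =
        outs₁∉ins₂ _ (subst (_ ∈_) (blockTrace-outHandles b₁) output) (lose (∈-blockTrace-ins b₂ m) o)
  ... | E , Φ₂≡ , disjoint , C₂′ with Comp-postpone C₁ E disjoint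
  ...   | Ψ₂ , C₁′ , same = Φ ++ E , Ψ₂ , C₂′ , C₁′ , subst (SameFrame sig Ψ₂) (sym Φ₂≡) same

  data InputReplacement (Φ : Frame sig) : Label sig → Label sig → Set where
    keep    : ∀ {l} → InputReplacement Φ l l
    replace : ∀ {c M₁ M₂} → RecipeOver sig Φ M₂ → applyR sig Φ M₁ =E applyR sig Φ M₂ → Valid (applyR sig Φ M₂)
            → InputReplacement Φ (lin c M₁) (lin c M₂)

  outputs-unreplaced : All IsOut tr₁ → Pointwise (InputReplacement Φ) tr₁ tr₂ → tr₁ ≡ tr₂
  outputs-unreplaced []            []                    = refl
  outputs-unreplaced (_ ∷ outputs) (keep ∷ rs)           = cong (_ ∷_) (outputs-unreplaced outputs rs)
  outputs-unreplaced (() ∷ _)      (replace _ _ _ ∷ _)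

  Comp-relabel : Comp ℓ Q Φ tr₁ R Φ′ → Pointwise (InputReplacement Φ) tr₁ tr₂ → Comp ℓ Q Φ tr₂ R Φ′
  Comp-relabel (c-in lvl step@(s-in _ _ _ _) C) (keep ∷ rs) = c-in lvl step (Comp-relabel C rs)
  Comp-relabel (c-in lvl (s-in _ eq _ valid′) C) (replace over equal valid ∷ rs) =
    c-in lvl (s-in over (E-trans (E-sym equal) eq) valid valid′) (Comp-relabel C rs)
  Comp-relabel (c-out lvl step C) (keep ∷ rs) =
    c-out lvl step (subst (λ tr → Comp o* _ _ tr _ _) (outputs-unreplaced (Comp-o*-outputs C) rs) C)
  Comp-relabel (c-tau step@(s-then _ _ _) C) rs = c-tau step (Comp-relabel C rs)
  Comp-relabel (c-tau step@(s-else _) C)     rs = c-tau step (Comp-relabel C rs)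
  Comp-relabel o-nil       [] = o-nil
  Comp-relabel o-inp       [] = o-inp
  Comp-relabel (o-out inv) [] = o-out inv
  Comp-relabel i-nil       [] = i-nil
  Comp-relabel (i-out inv) [] = i-out inv

  BlockEq⇒InputReplacement : ∀ b₁ b₂ → Φ₁ ⊆F Φ → BlockEq Φ b₁ b₂
    → All (RecipeOver sig Φ₁) (ins b₁) → All (RecipeOver sig Φ₁) (ins b₂)
    → Pointwise (InputReplacement Φ₁) (blockTrace sig b₁) (blockTrace sig b₂)
  BlockEq⇒InputReplacement {Φ₁ = Φ₁} {Φ = Φ} (io c Ms₁ Os) (io .c Ms₂ .Os) sub (refl , equal-ins , refl)
                           over₁ over₂ =
    Pointwise.++⁺ (Pointwise.map⁺ (lin c) (lin c) (inputs equal-ins over₁ over₂)) (Pointwise.refl keep)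
    where
      restrict : ∀ {M} → RecipeOver sig Φ₁ M → applyR sig Φ M ≡ applyR sig Φ₁ M
      restrict over = applyR-transfer over (λ w _ → ⊆F-lookup sub w)
      inputs : ∀ {Ms₁ Ms₂} → Pointwise (RecipeEq Φ) Ms₁ Ms₂
        → All (RecipeOver sig Φ₁) Ms₁ → All (RecipeOver sig Φ₁) Ms₂
        → Pointwise (λ M₁ M₂ → InputReplacement Φ₁ (lin c M₁) (lin c M₂)) Ms₁ Ms₂
      inputs [] [] [] = []
      inputs ((equal , _ , valid) ∷ es) (over₁ ∷ os₁) (over₂ ∷ os₂) =
        replace over₂ (subst₂ _=E_ (restrict over₁) (restrict over₂) equal) (subst Valid (restrict over₂) valid)
          ∷ inputs es os₁ os₂

  Independent-sym : Independent sig b₁ b₂ → Independent sig b₂ b₁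
  Independent-sym (apart , outs₂∉ins₁ , outs₁∉ins₂) = (λ eq → apart (sym eq)) , outs₁∉ins₂ , outs₂∉ins₁

  BlockEq-sym : BlockEq Φ b₁ b₂ → BlockEq Φ b₂ b₁
  BlockEq-sym (same-ch , equal-ins , same-outs) = sym same-ch , flip equal-ins , sym same-outs
    where
      flip : ∀ {Ms₁ Ms₂} → Pointwise (RecipeEq Φ) Ms₁ Ms₂ → Pointwise (RecipeEq Φ) Ms₂ Ms₁
      flip [] = []
      flip ((equal , valid₁ , valid₂) ∷ es) = (E-sym equal , valid₂ , valid₁) ∷ flip es

  data BlockRun : List (Proc sig) → Frame sig → List (Block sig) → List (Proc sig) → Frame sig → Set where
    stop : ∀ {𝒫 Φ} → BlockRun 𝒫 Φ [] 𝒫 Φ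
    next : ∀ {𝒫 Φ b bs Q Q′ 𝒫₁ Φ₁ 𝒫₂ Φ₂} → Update 𝒫 Q Q′ 𝒫₁ → Comp i+ Q Φ (blockTrace sig b) (just Q′) Φ₁
         → BlockRun 𝒫₁ Φ₁ bs 𝒫₂ Φ₂ → BlockRun 𝒫 Φ (b ∷ bs) 𝒫₂ Φ₂

  private variable
    𝒫 𝒫′ 𝒫₀ 𝒫₁ : List (Proc sig)
    cs : List Chan

  BlockRun⇒CSteps : BlockRun 𝒫 Φ bs 𝒫′ Φ′ → CSteps 𝒫 Φ (flatten sig bs) 𝒫′ Φ′
  BlockRun⇒CSteps stop = done
  BlockRun⇒CSteps (next u C r) with Update-split u
  ... | _ , _ , refl , refl = more (cs-live C) (BlockRun⇒CSteps r)

  CStep-begins : CStep 𝒫 Φ tr 𝒫′ Φ′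
               → Σ[ c ∈ Chan ] Σ[ M ∈ Recipe sig ] Σ[ rest ∈ List (Label sig) ] tr ≡ lin c M ∷ rest
  CStep-begins (cs-live C) = Comp-i+-begins C
  CStep-begins (cs-dead C) = Comp-i+-begins C

  CStep-from-[] : CStep 𝒫 Φ tr 𝒫′ Φ′ → 𝒫 ≢ []
  CStep-from-[] (cs-live {pre = pre} _) eq with ++-conicalʳ pre _ eq
  ... | ()
  CStep-from-[] (cs-dead {pre = pre} _) eq with ++-conicalʳ pre _ eq
  ... | ()

  CSteps-from-[] : CSteps 𝒫 Φ tr 𝒫′ Φ′ → 𝒫 ≡ [] → tr ≡ []
  CSteps-from-[] done         _  = refl
  CSteps-from-[] (more step _) eq = ⊥-elim (CStep-from-[] step eq)

  CSteps-NoLeadingOutput : CSteps 𝒫 Φ tr 𝒫′ Φ′ → NoLeadingOutput tr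
  CSteps-NoLeadingOutput done = tt
  CSteps-NoLeadingOutput (more step _) with CStep-begins step
  ... | _ , _ , _ , refl = tt

  -- A step's trace is in*·out⁺ and the following trace starts with an input, so the
  -- step boundaries of a run of proper blocks are exactly the block boundaries.
  CSteps⇒BlockRun : CSteps 𝒫 Φ tr 𝒫′ Φ′ → ∀ bs → tr ≡ flatten sig bs → All (Proper sig) bs → BlockRun 𝒫 Φ bs 𝒫′ Φ′
  CSteps⇒BlockRun done []                      _  _              = stop
  CSteps⇒BlockRun done (io _ [] _ ∷ _)         _  ((() , _) ∷ _)
  CSteps⇒BlockRun done (io _ (_ ∷ _) _ ∷ _)    () _
  CSteps⇒BlockRun (more step _) [] eq _ with CStep-begins step
  ... | _ , _ , _ , refl with eq
  ...   | ()
  CSteps⇒BlockRun (more (cs-live {pre = pre} C) steps) (b ∷ bs) eq (proper ∷ propers)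
    with BlockShaped-++-cancel (Comp-live-BlockShaped in-i+ C) (Proper⇒BlockShaped b proper)
                               (CSteps-NoLeadingOutput steps) (NoLeadingOutput-flatten propers) eq
  ... | refl , rest≡ = next (Update-++ pre) C (CSteps⇒BlockRun steps bs rest≡ propers)
  CSteps⇒BlockRun (more {tr₁ = tr₁} {tr₂ = tr₂} (cs-dead C) steps) (b ∷ bs) eq (proper ∷ _) =
    ⊥-elim (BlockShaped-has-output (Proper⇒BlockShaped b proper)
                                   (AllP.++⁻ˡ (blockTrace sig b) (subst (All IsIn) eq all-inputs)))
    where
      all-inputs : All IsIn (tr₁ ++ tr₂)
      all-inputs = AllP.++⁺ (Comp-dead-inputs C) (subst (All IsIn) (sym (CSteps-from-[] steps refl)) [])

  BlockRun-split : ∀ bs → BlockRun 𝒫 Φ (bs ++ bs′) 𝒫′ Φ′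
    → Σ[ 𝒫₁ ∈ List (Proc sig) ] Σ[ Φ₁ ∈ Frame sig ] BlockRun 𝒫 Φ bs 𝒫₁ Φ₁ × BlockRun 𝒫₁ Φ₁ bs′ 𝒫′ Φ′
  BlockRun-split []       r            = _ , _ , stop , r
  BlockRun-split (_ ∷ bs) (next u C r) with BlockRun-split bs r
  ... | _ , _ , r₁ , r₂ = _ , _ , next u C r₁ , r₂

  _++ᴿ_ : BlockRun 𝒫 Φ bs 𝒫₁ Φ₁ → BlockRun 𝒫₁ Φ₁ bs′ 𝒫′ Φ′ → BlockRun 𝒫 Φ (bs ++ bs′) 𝒫′ Φ′
  stop         ++ᴿ r′ = r′
  next u C r   ++ᴿ r′ = next u C (r ++ᴿ r′)

  BlockRun-⊆F : BlockRun 𝒫 Φ bs 𝒫′ Φ′ → Φ ⊆F Φ′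
  BlockRun-⊆F stop         = mk⊆F λ _ _ → refl
  BlockRun-⊆F (next _ C r) = ⊆F-trans (Comp-⊆F C) (BlockRun-⊆F r)

  BlockRun-BasicOn : Pointwise (BasicOn sig) cs 𝒫 → BlockRun 𝒫 Φ bs 𝒫′ Φ′ → Pointwise (BasicOn sig) cs 𝒫′
  BlockRun-BasicOn basic stop         = basic
  BlockRun-BasicOn basic (next u C r) = BlockRun-BasicOn (Update-BasicOn basic u (Comp-BasicOn C)) r

  BlockRun-inputs-over : ∀ {H} → BlockRun 𝒫 Φ bs 𝒫₁ Φ₁ → (∀ {w} → w ∈ H → Dom w Φ)
    → PlausibleFrom sig H (bs ++ b ∷ bs′) → All (RecipeOver sig Φ₁) (ins b)
  BlockRun-inputs-over stop inH (uses , _) = All.map (λ handles w o → inH (handles w o)) uses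
  BlockRun-inputs-over {H = H} (next {b = b} _ C r) inH (_ , plausible) = BlockRun-inputs-over r inH′ plausible
    where
      inH′ : ∀ {w} → w ∈ H ++ outs b → Dom w _
      inH′ m with AnyP.++⁻ H m
      ... | inj₁ m-H    = ⊆F-dom (Comp-⊆F C) (inH m-H)
      ... | inj₂ m-outs = Comp-dom⁺ C (subst (_ ∈_) (sym (blockTrace-outHandles b)) m-outs)

  BlockRun-transport : BlockRun 𝒫 Φ bs 𝒫′ Φ′ → SameFrame sig Ψ Φ
    → Σ[ Ψ′ ∈ Frame sig ] BlockRun 𝒫 Ψ bs 𝒫′ Ψ′ × SameFrame sig Ψ′ Φ′
  BlockRun-transport stop same = _ , stop , same
  BlockRun-transport {Φ = Φ} {Ψ = Ψ} (next u C r) same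
    with Comp-reframe C Ψ (λ _ w _ _ → same w) (λ _ → ⊆F-dom (mk⊆F λ w _ → sym (same w)))
  ... | ext , refl , _ , C′ with BlockRun-transport {Ψ = Ψ ++ ext} r (SameFrame-++ Ψ Φ ext same)
  ...   | Ψ′ , r′ , same′ = Ψ′ , next u C′ r′ , same′

  BlockRun-swap : ∀ bs b₁ b₂ → Pointwise (BasicOn sig) cs 𝒫 → Independent sig b₁ b₂
    → BlockRun 𝒫 Φ (bs ++ b₁ ∷ b₂ ∷ bs′) 𝒫′ Φ′
    → Σ[ Ψ ∈ Frame sig ] BlockRun 𝒫 Φ (bs ++ b₂ ∷ b₁ ∷ bs′) 𝒫′ Ψ × SameFrame sig Ψ Φ′
  BlockRun-swap bs b₁ b₂ basic independent r with BlockRun-split bs r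
  ... | _ , _ , r₁ , next u₁ C₁ (next u₂ C₂ r₃)
    with Comp-swap b₁ b₂ independent C₁ C₂
       | Update-comm (BlockRun-BasicOn basic r₁) u₁ u₂ (Comp-BasicOn C₁) apart
    where
      apart : ∀ {c} → BasicOn sig c _ → ¬ BasicOn sig c _
      apart on₁ on₂ =
        proj₁ independent (trans (Comp-block-channel b₁ C₁ on₁) (sym (Comp-block-channel b₂ C₂ on₂)))
  ...   | _ , _ , C₂′ , C₁′ , same | _ , u₂′ , u₁′ with BlockRun-transport r₃ same
  ...     | Ψ , r₃′ , same′ = Ψ , r₁ ++ᴿ next u₂′ C₂′ (next u₁′ C₁′ r₃′) , same′

  BlockRun-replace : ∀ bs b₁ b₂ → Plausible sig (bs ++ b₁ ∷ bs′) → Plausible sig (bs ++ b₂ ∷ bs′)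
    → BlockEq Φ b₁ b₂ → SameFrame sig Φ′ Φ
    → BlockRun 𝒫 Φ₀ (bs ++ b₁ ∷ bs′) 𝒫′ Φ′ → BlockRun 𝒫 Φ₀ (bs ++ b₂ ∷ bs′) 𝒫′ Φ′
  BlockRun-replace bs b₁ b₂ plausible₁ plausible₂ equal same r with BlockRun-split bs r
  ... | _ , Φ₁ , r₁ , run@(next u C r₂) =
    r₁ ++ᴿ next u (Comp-relabel C replacement) r₂
    where
      replacement : Pointwise (InputReplacement Φ₁) (blockTrace sig b₁) (blockTrace sig b₂)
      replacement =
        BlockEq⇒InputReplacement b₁ b₂ (⊆F-trans (BlockRun-⊆F run) (mk⊆F λ w _ → sym (same w))) equal
          (BlockRun-inputs-over r₁ (λ ()) plausible₁) (BlockRun-inputs-over r₁ (λ ()) plausible₂)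

  RunsTo : List (Proc sig) → Frame sig → List (Proc sig) → Frame sig → List (Block sig) → Set
  RunsTo 𝒫₀ Φ₀ 𝒫 Φ bs = Σ[ Φ′ ∈ Frame sig ] BlockRun 𝒫₀ Φ₀ bs 𝒫 Φ′ × SameFrame sig Φ′ Φ

  RunsTo-swap : ∀ bs b₁ b₂ → Pointwise (BasicOn sig) cs 𝒫₀ → Independent sig b₁ b₂
    → RunsTo 𝒫₀ Φ₀ 𝒫 Φ (bs ++ b₁ ∷ b₂ ∷ bs′) → RunsTo 𝒫₀ Φ₀ 𝒫 Φ (bs ++ b₂ ∷ b₁ ∷ bs′)
  RunsTo-swap bs b₁ b₂ basic independent (_ , r , same) with BlockRun-swap bs b₁ b₂ basic independent r
  ... | Ψ , r′ , same′ = Ψ , r′ , λ w → trans (same′ w) (same w)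

  RunsTo-replace : ∀ bs b₁ b₂ → Plausible sig (bs ++ b₁ ∷ bs′) → Plausible sig (bs ++ b₂ ∷ bs′) → BlockEq Φ b₁ b₂
    → RunsTo 𝒫₀ Φ₀ 𝒫 Φ (bs ++ b₁ ∷ bs′) → RunsTo 𝒫₀ Φ₀ 𝒫 Φ (bs ++ b₂ ∷ bs′)
  RunsTo-replace bs b₁ b₂ plausible₁ plausible₂ equal (Φ′ , r , same) =
    Φ′ , BlockRun-replace bs b₁ b₂ plausible₁ plausible₂ equal same r , same

  RunsTo-≡Φ : Pointwise (BasicOn sig) cs 𝒫₀ → TrEquiv Φ bs bs′ → RunsTo 𝒫₀ Φ₀ 𝒫 Φ bs ⇔ RunsTo 𝒫₀ Φ₀ 𝒫 Φ bs′
  RunsTo-≡Φ basic (te-refl _)        = ⇔-id _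
  RunsTo-≡Φ basic (te-sym e)         = ⇔-sym (RunsTo-≡Φ basic e)
  RunsTo-≡Φ basic (te-trans e₁ e₂)   = RunsTo-≡Φ basic e₂ ⇔-∘ RunsTo-≡Φ basic e₁
  RunsTo-≡Φ {Φ = Φ} basic (te-swap {bs} {b₁} {b₂} _ _ independent) =
    mk⇔ (RunsTo-swap {Φ = Φ} bs b₁ b₂ basic independent)
        (RunsTo-swap {Φ = Φ} bs b₂ b₁ basic (Independent-sym independent))
  RunsTo-≡Φ basic (te-repl {bs} {b₁} {b₂} plausible₁ plausible₂ equal) =
    mk⇔ (RunsTo-replace bs b₁ b₂ plausible₁ plausible₂ equal)
        (RunsTo-replace bs b₂ b₁ plausible₂ plausible₁ (BlockEq-sym equal))

lemma2 : (T : Theory) → let open Model T in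
    (𝒫₀ : List (Proc sig)) (Φ₀ : Frame sig) (tr : List (Block sig))
    (𝒫 : List (Proc sig)) (Φ : Frame sig)
    → ExtSimple 𝒫₀ Φ₀
    → All (Proper sig) tr
    → CSteps 𝒫₀ Φ₀ (flatten sig tr) 𝒫 Φ
    → (tr' : List (Block sig)) → TrEquiv Φ tr' tr
    → Σ[ 𝒫' ∈ List (Proc sig) ] Σ[ Φ' ∈ Frame sig ]
        (CSteps 𝒫₀ Φ₀ (flatten sig tr') 𝒫' Φ' × (𝒫' ↭ 𝒫) × SameFrame sig Φ' Φ)
lemma2 T 𝒫₀ Φ₀ tr 𝒫 Φ ((_ , basic , _) , _) proper steps tr' tr'≡tr =
  let Φ' , run , Φ'≈Φ = Equivalence.from (RunsTo-≡Φ basic tr'≡tr)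
                          (Φ , CSteps⇒BlockRun steps tr refl proper , λ _ → refl)
  in 𝒫 , Φ' , BlockRun⇒CSteps run , ↭-refl , Φ'≈Φ
  where open Compressed T
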